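{- For every $n\ge1$ and every permutation $\pi$ of $[n]$, $pbid(\pi)\le 2\left\lceil\frac{b(\pi)-1}{3}\right\rceil$.
   Context: Permutations of $[n]=\{1,\dots,n\}$ are written as sequences $\pi=\langle\pi_1\,\pi_2\cdots\pi_n\rangle$ with $\pi_i=\pi(i)$; products are compositions applied right to left, so $(\pi\sigma)_i=\pi_{\sigma(i)}$; $\iota=\langle 1\,2\cdots n\rangle$ is the identity. For $1\le i<j\le k<\ell\le n+1$, the block-interchange $\beta(i,j,k,\ell)$ is the permutation $\langle 1\cdots i-1\;\; k\cdots \ell-1\;\; j\cdots k-1\;\; i\cdots j-1\;\; \ell\cdots n\rangle$, so that $\pi\beta(i,j,k,\ell)$ is obtained from $\pi$ by exchanging the blocks $\pi_i\cdots\pi_{j-1}$ and $\pi_k\cdots\pi_{\ell-1}$. A prefix block-interchange is a block-interchange with $i=1$. $pbid(\pi)$ denotes the minimum $t\ge 0$ such that there are prefix block-interchanges $\beta_1,\dots,\beta_t$ with $\pi\beta_1\cdots\beta_t=\iota$. Breakpoints: extend $\pi$ to $\langle \pi_0\,\pi_1\cdots\pi_n\,\pi_{n+1}\rangle$ with $\pi_0=0$, $\pi_{n+1}=n+1$; for $0\le i\le n$ the pair $(\pi_i,\pi_{i+1})$ is a breakpoint if $i=0$ or $\pi_{i+1}-\pi_i\neq1$. $b(\pi)$ is the number of breakpoints. -}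

module Defs where

open import Data.Nat using (ℕ; zero; suc; _+_; _∸_; _≤_; _<_; _<ᵇ_; _≡ᵇ_)
open import Data.Nat.Properties using (_≟_)
open import Data.Bool using (Bool; true; false; if_then_else_)
open import Data.List using (List; []; _∷_; length)
open import Data.List.Relation.Unary.All using (All)
open import Data.Product using (_×_; _,_)
open import Relation.Binary.PropositionalEquality using (_≡_; _≢_)
open import Relation.Nullary using (¬_; yes; no)

-- Permutations of [n] = {1,…,n} are represented as functions ℕ → ℕ,
-- only their values on positions 1..n matter (π i = π_i).
IsPerm : ℕ → (ℕ → ℕ) → Set
IsPerm n π =
  (∀ i → 1 ≤ i → i ≤ n → (1 ≤ π i × π i ≤ n)) ×
  (∀ i j → 1 ≤ i → i ≤ n → 1 ≤ j → j ≤ n → π i ≡ π j → i ≡ j)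

IsIdentity : ℕ → (ℕ → ℕ) → Set
IsIdentity n π = ∀ i → 1 ≤ i → i ≤ n → π i ≡ i

-- Prefix block-interchange β(1,j,k,ℓ) as a map on positions (1-indexed):
-- ⟨ k ⋯ ℓ-1  j ⋯ k-1  1 ⋯ j-1  ℓ ⋯ n ⟩, identity outside [1, ℓ-1].
pbi : ℕ → ℕ → ℕ → ℕ → ℕ
pbi j k ℓ x =
  if x <ᵇ 1 then x
  else if x <ᵇ 1 + (ℓ ∸ k) then k + (x ∸ 1)
  else if x <ᵇ 1 + (ℓ ∸ k) + (k ∸ j) then j + (x ∸ 1 ∸ (ℓ ∸ k))
  else if x <ᵇ ℓ then 1 + (x ∸ 1 ∸ (ℓ ∸ k) ∸ (k ∸ j))
  else x

ValidPBI : ℕ → ℕ × ℕ × ℕ → Set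
ValidPBI n (j , k , ℓ) = (1 < j) × (j ≤ k) × (k < ℓ) × (ℓ ≤ n + 1)

-- π β₁ β₂ ⋯ β_t  with (πσ)_i = π_{σ(i)}
applyPBIs : (ℕ → ℕ) → List (ℕ × ℕ × ℕ) → (ℕ → ℕ)
applyPBIs π [] = π
applyPBIs π ((j , k , ℓ) ∷ βs) = applyPBIs (λ x → π (pbi j k ℓ x)) βs

SortableIn : ℕ → (ℕ → ℕ) → ℕ → Set
SortableIn n π t =
  Data.Product.Σ (List (ℕ × ℕ × ℕ)) λ βs →
    (length βs ≡ t) × All (ValidPBI n) βs × IsIdentity n (applyPBIs π βs)

-- pbid(π) ≤ m  (pbid is the minimum t with SortableIn n π t)
PbidAtMost : ℕ → (ℕ → ℕ) → ℕ → Set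
PbidAtMost n π m = Data.Product.Σ ℕ λ t → t ≤ m × SortableIn n π t

ext : ℕ → (ℕ → ℕ) → ℕ → ℕ
ext n π zero = zero
ext n π (suc x) = if suc x ≡ᵇ suc n then suc n else π (suc x)

isBreakpoint : ℕ → (ℕ → ℕ) → ℕ → Bool
isBreakpoint n π zero = true
isBreakpoint n π (suc i) with ext n π (suc (suc i)) ≟ suc (ext n π (suc i))
... | yes _ = false
... | no _ = true

-- number of breakpoints among positions i = 0 .. m-1
countBP : ℕ → (ℕ → ℕ) → ℕ → ℕ
countBP n π zero = zero
countBP n π (suc m) = (if isBreakpoint n π m then 1 else 0) + countBP n π m

b : ℕ → (ℕ → ℕ) → ℕ
b n π = countBP n π (suc n)

module Submission where

-- Induction on b(π): the identity needs no move, and from every π ≠ ι either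
-- one prefix interchange sorts π, or two of them remove three breakpoints.
-- The interchange β(1,j,k,ℓ) turns the blocks A B C D of π into C B A D, so
-- with E = ⟨0 π₁ ⋯ πₙ n+1⟩ only the breakpoints at block junctions change;
-- this gives exact counting identities (`interchange-count`, and
-- `transposition-count` for B empty).  From them we build two moves:
--  * π₁ = a+1 ≠ 1 (`two-gain-move`): with a at position r, take e > a at a
--    position p < r such that e+1 sits at ℓ > r; moving A = [1,p], B = (p,r],
--    C = (r,ℓ) creates the adjacencies (a,a+1), (e,e+1): two breakpoints fewer;
--  * π₁ = 1, π ≠ ι (`one-gain-move`): if 1,…,p are fixed and πₚ₊₁ ≠ p+1,
--    bringing p+1 behind the fixed prefix removes a breakpoint and the new
--    first entry is not 1.
-- A 1-move then a 2-move, or a 2-move then any move, removes three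
-- breakpoints (`progress`); the arithmetic of the bound closes the induction.

open import Defs
open import Data.Nat using (ℕ; zero; suc; pred; >-nonZero; _≤_; _<_; _*_; _∸_; _+_; _/_; _<ᵇ_; _≡ᵇ_; z≤n; s≤s; s≤s⁻¹)
open import Data.Nat.Properties
open import Data.Nat.Tactic.RingSolver using (solve-∀)
open import Data.Bool using (true; false; if_then_else_)
open import Data.Fin using (Fin; toℕ; fromℕ<; punchOut)
open import Data.Fin.Properties using (any?; toℕ<n; toℕ-fromℕ<; toℕ-injective; punchOut-injective; injective⇒≤)
open import Data.List using ([]; _∷_)
open import Data.List.Relation.Unary.All using ([]; _∷_)
open import Data.Product using (Σ; _×_; _,_; proj₁; proj₂)
open import Data.Sum using (inj₁; inj₂)
open import Data.Empty using (⊥-elim)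
open import Relation.Nullary using (¬_; yes; no; Dec; _×-dec_)
open import Relation.Binary using (tri<; tri≈; tri>)
open import Data.Nat.DivMod using (+-distrib-/-∣ʳ; /-monoˡ-≤)
open import Data.Nat.Divisibility using (∣-refl)
open import Relation.Binary.PropositionalEquality

<ᵇ-true : ∀ {m n} → m < n → (m <ᵇ n) ≡ true
<ᵇ-true {zero} {suc n} _ = refl
<ᵇ-true {suc m} {suc n} (s≤s h) = <ᵇ-true h

<ᵇ-false : ∀ {m n} → n ≤ m → (m <ᵇ n) ≡ false
<ᵇ-false {m} {zero} _ = refl
<ᵇ-false {suc m} {suc n} (s≤s h) = <ᵇ-false h

≡ᵇ-false : ∀ {m n} → m ≢ n → (m ≡ᵇ n) ≡ false
≡ᵇ-false {zero} {zero} ne = ⊥-elim (ne refl)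
≡ᵇ-false {zero} {suc n} ne = refl
≡ᵇ-false {suc m} {zero} ne = refl
≡ᵇ-false {suc m} {suc n} ne = ≡ᵇ-false {m} {n} (λ e → ne (cong suc e))

≡ᵇ-refl : ∀ n → (n ≡ᵇ n) ≡ true
≡ᵇ-refl zero = refl
≡ᵇ-refl (suc n) = ≡ᵇ-refl n

pbi-readsC : ∀ {j k ℓ γ} → ℓ ∸ k ≡ suc γ → ∀ u → u ≤ γ → pbi j k ℓ (suc u) ≡ k + u
pbi-readsC {j} {k} {ℓ} {γ} e u h rewrite e | <ᵇ-true {u} {suc γ} (s≤s h) = refl

pbi-readsB : ∀ {j k ℓ β γ} → ℓ ∸ k ≡ suc γ → k ∸ j ≡ β → ∀ u → u < β →
  pbi j k ℓ (suc (suc γ + u)) ≡ j + u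
pbi-readsB {j} {k} {ℓ} {β} {γ} e1 e2 u h rewrite e1 | e2
  | <ᵇ-false {suc γ + u} {suc γ} (m≤m+n (suc γ) u)
  | <ᵇ-true {suc γ + u} {suc γ + β} (+-monoʳ-< (suc γ) h)
  | m+n∸m≡n (suc γ) u = refl

pbi-readsA : ∀ {j k ℓ β γ} → ℓ ∸ k ≡ suc γ → k ∸ j ≡ β → ∀ u → suc (suc γ + β + u) < ℓ →
  pbi j k ℓ (suc (suc γ + β + u)) ≡ suc u
pbi-readsA {j} {k} {ℓ} {β} {γ} e1 e2 u h rewrite e1 | e2
  | <ᵇ-false {suc γ + β + u} {suc γ} (≤-trans (m≤m+n (suc γ) β) (m≤m+n (suc γ + β) u))
  | <ᵇ-false {suc γ + β + u} {suc γ + β} (m≤m+n (suc γ + β) u)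
  | <ᵇ-true h = cong suc (cancel γ β u)
  where
  cancel : ∀ a b c → a + b + c ∸ a ∸ b ≡ c
  cancel a b c rewrite +-assoc a b c | m+n∸m≡n a (b + c) = m+n∸m≡n b c

pbi-fixesD : ∀ {j k ℓ β γ} → ℓ ∸ k ≡ suc γ → k ∸ j ≡ β → ∀ x → suc γ + β ≤ x → ℓ ≤ suc x →
  pbi j k ℓ (suc x) ≡ suc x
pbi-fixesD {j} {k} {ℓ} {β} {γ} e1 e2 x h1 h2 rewrite e1 | e2
  | <ᵇ-false {x} {suc γ} (≤-trans (m≤m+n (suc γ) β) h1)
  | <ᵇ-false {x} {suc γ + β} h1
  | <ᵇ-false h2 = refl

brk : ℕ → ℕ → ℕ
brk u w with w ≟ suc u
... | yes _ = 0
... | no _ = 1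

brk-adjacent : ∀ {u u' w} → u ≡ u' → w ≡ suc u' → brk u w ≡ 0
brk-adjacent {u} refl refl with suc u ≟ suc u
... | yes _ = refl
... | no ne = ⊥-elim (ne refl)

brk-gap : ∀ {u u' w w'} → u ≡ u' → w ≡ w' → w' ≢ suc u' → brk u w ≡ 1
brk-gap {u} {w = w} refl refl ne with w ≟ suc u
... | yes e = ⊥-elim (ne e)
... | no _ = refl

brk≤1 : ∀ u w → brk u w ≤ 1
brk≤1 u w with w ≟ suc u
... | yes _ = z≤n
... | no _ = s≤s z≤n

brks : (ℕ → ℕ) → ℕ → ℕ → ℕ
brks E a zero = 0
brks E a (suc l) = brk (E a) (E (suc a)) + brks E (suc a) l

brks-split : ∀ E a l1 l2 → brks E a (l1 + l2) ≡ brks E a l1 + brks E (a + l1) l2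
brks-split E a zero l2 = cong (λ z → brks E z l2) (sym (+-identityʳ a))
brks-split E a (suc l1) l2 =
  trans (cong (brk (E a) (E (suc a)) +_)
          (trans (brks-split E (suc a) l1 l2) (cong (λ z → brks E (suc a) l1 + brks E z l2) (sym (+-suc a l1)))))
        (sym (+-assoc (brk (E a) (E (suc a))) _ _))

brks-shift : ∀ E E' a a' l → (∀ u → u ≤ l → E' (a' + u) ≡ E (a + u)) → brks E' a' l ≡ brks E a l
brks-shift E E' a a' zero h = refl
brks-shift E E' a a' (suc l) h = cong₂ _+_ (cong₂ brk first second) (brks-shift E E' (suc a) (suc a') l h')
  where
  first : E' a' ≡ E a
  first = trans (cong E' (sym (+-identityʳ a'))) (trans (h 0 z≤n) (cong E (+-identityʳ a)))
  second : E' (suc a') ≡ E (suc a)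
  second = trans (cong E' (sym (+-comm a' 1))) (trans (h 1 (s≤s z≤n)) (cong E (+-comm a 1)))
  h' : ∀ u → u ≤ l → E' (suc a' + u) ≡ E (suc a + u)
  h' u hu = trans (cong E' (sym (+-suc a' u))) (trans (h (suc u) (s≤s hu)) (cong E (+-suc a u)))

isBreakpoint≡brk : ∀ n π i → (if isBreakpoint n π (suc i) then 1 else 0) ≡ brk (ext n π (suc i)) (ext n π (suc (suc i)))
isBreakpoint≡brk n π i with ext n π (suc (suc i)) ≟ suc (ext n π (suc i))
... | yes _ = refl
... | no _ = refl

-- The breakpoint (0 , π₁) is always counted; the others are the pairs (E x , E (x+1)), 1 ≤ x ≤ m.
countBP≡1+brks : ∀ n π m → countBP n π (suc m) ≡ suc (brks (ext n π) 1 m)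
countBP≡1+brks n π zero = refl
countBP≡1+brks n π (suc m) = begin
    (if isBreakpoint n π (suc m) then 1 else 0) + countBP n π (suc m)
  ≡⟨ cong₂ _+_ (isBreakpoint≡brk n π m) (countBP≡1+brks n π m) ⟩
    last + suc (brks E 1 m)
  ≡⟨ +-suc last _ ⟩
    suc (last + brks E 1 m)
  ≡⟨ cong suc (trans (+-comm last (brks E 1 m)) (cong (brks E 1 m +_) (sym (+-identityʳ last)))) ⟩
    suc (brks E 1 m + (last + 0))
  ≡⟨ cong suc (sym (brks-split E 1 m 1)) ⟩
    suc (brks E 1 (m + 1))
  ≡⟨ cong (λ z → suc (brks E 1 z)) (+-comm m 1) ⟩
    suc (brks E 1 (suc m)) ∎
  where open ≡-Reasoning
        E : ℕ → ℕ
        E = ext n π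
        last : ℕ
        last = brk (E (suc m)) (E (suc (suc m)))

b≥1 : ∀ n π → 1 ≤ b n π
b≥1 n π rewrite countBP≡1+brks n π n = s≤s z≤n

ext-inner : ∀ n π x → suc x ≤ n → ext n π (suc x) ≡ π (suc x)
ext-inner n π x h rewrite ≡ᵇ-false {x} {n} (λ e → <-irrefl e h) = refl

ext-position : ∀ n π p → 1 ≤ p → p ≤ n → ext n π p ≡ π p
ext-position n π (suc x) _ h = ext-inner n π x h

ext-top : ∀ n π → ext n π (suc n) ≡ suc n
ext-top n π rewrite ≡ᵇ-refl n = refl

-- The interchange with |A| = α+1, |B| = β, |C| = γ+1, i.e. j = α+2,
-- k = j+β, ℓ = k+γ+1, and the extended sequences E of π and E' of the result.
module Interchange (n : ℕ) (π : ℕ → ℕ) (α β γ : ℕ) where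
  j k ℓ : ℕ
  j = suc (suc α)
  k = j + β
  ℓ = k + suc γ

  π' : ℕ → ℕ
  π' x = π (pbi j k ℓ x)

  E E' : ℕ → ℕ
  E = ext n π
  E' = ext n π'

  |C| : ℓ ∸ k ≡ suc γ
  |C| = m+n∸m≡n k (suc γ)
  |B| : k ∸ j ≡ β
  |B| = m+n∸m≡n j β

  valid : ℓ ≤ suc n → ValidPBI n (j , k , ℓ)
  valid ℓ≤n+1 = s≤s (s≤s z≤n) , m≤m+n j β , m<m+n k (s≤s z≤n) , ≤-trans ℓ≤n+1 (≤-reflexive (+-comm 1 n))

  module _ (ℓ≤n+1 : ℓ ≤ suc n) where
    private
      inner : ∀ {x} → x < ℓ → x ≤ n
      inner h = s≤s⁻¹ (≤-trans h ℓ≤n+1)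

    E'-C : ∀ u → u ≤ γ → E' (suc u) ≡ E (k + u)
    E'-C u h = begin
        E' (suc u)
      ≡⟨ ext-inner n π' u (inner (≤-<-trans (+-monoˡ-≤ u (s≤s z≤n)) ku<ℓ)) ⟩
        π (pbi j k ℓ (suc u))
      ≡⟨ cong π (pbi-readsC {j} {k} {ℓ} |C| u h) ⟩
        π (k + u)
      ≡⟨ sym (ext-inner n π (suc (α + β + u)) (inner ku<ℓ)) ⟩
        E (k + u) ∎
      where open ≡-Reasoning
            ku<ℓ : k + u < ℓ
            ku<ℓ = +-monoʳ-< k (s≤s h)

    E'-B : ∀ u → u < β → E' (suc (suc γ + u)) ≡ E (j + u)
    E'-B u h = begin
        E' (suc (suc γ + u))
      ≡⟨ ext-inner n π' (suc γ + u) (inner new<ℓ) ⟩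
        π (pbi j k ℓ (suc (suc γ + u)))
      ≡⟨ cong π (pbi-readsB {j} {k} {ℓ} |C| |B| u h) ⟩
        π (j + u)
      ≡⟨ sym (ext-inner n π (suc (α + u)) (inner old<ℓ)) ⟩
        E (j + u) ∎
      where open ≡-Reasoning
            shuffle : ∀ α β γ → suc (suc (suc α + (γ + β))) ≡ suc (suc α) + β + suc γ
            shuffle = solve-∀
            new<ℓ : suc (suc γ + u) < ℓ
            new<ℓ = ≤-trans (s≤s (s≤s (+-monoʳ-< γ h)))
                      (≤-trans (s≤s (s≤s (m≤n+m (γ + β) (suc α)))) (≤-reflexive (shuffle α β γ)))
            old<ℓ : j + u < ℓ
            old<ℓ = ≤-trans (+-monoʳ-< j h) (m≤m+n k (suc γ))

    E'-A : ∀ u → u ≤ α → E' (suc (suc γ + β + u)) ≡ E (suc u)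
    E'-A u h = begin
        E' (suc (suc γ + β + u))
      ≡⟨ ext-inner n π' (suc γ + β + u) (inner new<ℓ) ⟩
        π (pbi j k ℓ (suc (suc γ + β + u)))
      ≡⟨ cong π (pbi-readsA {j} {k} {ℓ} |C| |B| u new<ℓ) ⟩
        π (suc u)
      ≡⟨ sym (ext-inner n π u (inner old<ℓ)) ⟩
        E (suc u) ∎
      where open ≡-Reasoning
            shuffle : ∀ α β γ → suc (suc (γ + β + suc α)) ≡ suc (suc α) + β + suc γ
            shuffle = solve-∀
            new<ℓ : suc (suc γ + β + u) < ℓ
            new<ℓ = ≤-trans (s≤s (s≤s (+-monoʳ-< (γ + β) (s≤s h)))) (≤-reflexive (shuffle α β γ))
            old<ℓ : suc u < ℓ
            old<ℓ = s≤s (s≤s (≤-trans h (≤-trans (m≤m+n α β) (m≤m+n (α + β) (suc γ)))))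

    E'-D : ∀ u → ℓ + u ≤ suc n → E' (ℓ + u) ≡ E (ℓ + u)
    E'-D u h with ℓ + u ≟ suc n
    ... | yes eq = trans (cong E' eq) (trans (ext-top n π') (sym (trans (cong E eq) (ext-top n π))))
    ... | no ne = begin
        E' (ℓ + u)
      ≡⟨ ext-inner n π' x x<n ⟩
        π (pbi j k ℓ (suc x))
      ≡⟨ cong π (pbi-fixesD {j} {k} {ℓ} |C| |B| x past-B (m≤m+n ℓ u)) ⟩
        π (suc x)
      ≡⟨ sym (ext-inner n π x x<n) ⟩
        E (ℓ + u) ∎
      where open ≡-Reasoning
            shuffle : ∀ α β γ u → β + suc γ + (suc α + u) ≡ suc (α + β + suc γ + u)
            shuffle = solve-∀
            x : ℕ
            x = suc (α + β + suc γ + u)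
            x<n : suc x ≤ n
            x<n = s≤s⁻¹ (≤∧≢⇒< h ne)
            past-B : suc γ + β ≤ x
            past-B = ≤-trans (≤-reflexive (+-comm (suc γ) β))
                       (≤-trans (m≤m+n (β + suc γ) (suc α + u)) (≤-reflexive (shuffle α β γ u)))

-- A prefix interchange maps a permutation to a permutation: pbi maps [1,n]
-- into itself, and swapping the roles of A and C gives a left inverse.
module PreservesPerm (n : ℕ) (π : ℕ → ℕ) (α β γ : ℕ) where
  open Interchange n π α β γ

  private
    ℓ-symmetric : ∀ α β γ → suc (suc γ) + β + suc α ≡ suc (suc α) + β + suc γ
    ℓ-symmetric = solve-∀
    posA-bound : ∀ α β γ → suc (suc (γ + β + suc α)) ≡ suc (suc α) + β + suc γ
    posA-bound = solve-∀
    posD-bound : ∀ α β γ → suc (suc α) + β + suc γ ≡ suc (suc γ + (β + suc α))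
    posD-bound = solve-∀

  data Region (x : ℕ) : Set where
    inC : ∀ u → u ≤ γ → x ≡ suc u → Region x
    inB : ∀ u → u < β → x ≡ suc (suc γ + u) → Region x
    inA : ∀ u → u ≤ α → x ≡ suc (suc γ + β + u) → Region x
    inD : ∀ y → x ≡ suc y → suc γ + β ≤ y → ℓ ≤ suc y → Region x

  region : ∀ y → Region (suc y)
  region y with y ≤? γ
  ... | yes h = inC y h refl
  ... | no h with m≤n⇒∃[o]m+o≡n (≰⇒> h)
  ... | u , refl with u <? β
  ... | yes h2 = inB u h2 refl
  ... | no h2 with m≤n⇒∃[o]m+o≡n (≮⇒≥ h2)
  ... | v , refl with v ≤? α
  ... | yes h3 = inA v h3 (cong suc (sym (+-assoc (suc γ) β v)))
  ... | no h3 = inD _ refl (+-monoʳ-≤ (suc γ) (m≤m+n β v))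
                  (≤-trans (≤-reflexive (posD-bound α β γ)) (s≤s (+-monoʳ-≤ (suc γ) (+-monoʳ-≤ β (≰⇒> h3)))))

  -- the inverse interchange: |A| = γ+1, |B| = β, |C| = α+1
  j⁻ k⁻ : ℕ
  j⁻ = suc (suc γ)
  k⁻ = j⁻ + β
  |C⁻| : ℓ ∸ k⁻ ≡ suc α
  |C⁻| = trans (cong (_∸ k⁻) (sym (ℓ-symmetric α β γ))) (m+n∸m≡n k⁻ (suc α))
  |B⁻| : k⁻ ∸ j⁻ ≡ β
  |B⁻| = m+n∸m≡n j⁻ β

  module _ (ℓ≤n+1 : ℓ ≤ suc n) where
    pbi-inverse : ∀ y → pbi j⁻ k⁻ ℓ (pbi j k ℓ (suc y)) ≡ suc y
    pbi-inverse y with region y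
    ... | inC u h refl = trans (cong (pbi j⁻ k⁻ ℓ) (pbi-readsC {j} {k} {ℓ} |C| u h))
                          (pbi-readsA {j⁻} {k⁻} {ℓ} {β} {α} |C⁻| |B⁻| u (+-monoʳ-< k (s≤s h)))
    ... | inB u h refl = trans (cong (pbi j⁻ k⁻ ℓ) (pbi-readsB {j} {k} {ℓ} |C| |B| u h))
                          (pbi-readsB {j⁻} {k⁻} {ℓ} {β} {α} |C⁻| |B⁻| u h)
    ... | inA u h refl = trans (cong (pbi j⁻ k⁻ ℓ) (pbi-readsA {j} {k} {ℓ} |C| |B| u
                              (≤-trans (s≤s (s≤s (+-monoʳ-< (γ + β) (s≤s h)))) (≤-reflexive (posA-bound α β γ)))))
                          (pbi-readsC {j⁻} {k⁻} {ℓ} {α} |C⁻| u h)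
    ... | inD y' refl h1 h2 = trans (cong (pbi j⁻ k⁻ ℓ) (pbi-fixesD {j} {k} {ℓ} |C| |B| y' h1 h2))
                          (pbi-fixesD {j⁻} {k⁻} {ℓ} {β} {α} |C⁻| |B⁻| y' (≤-trans (s≤s (m≤m+n (α + β) (suc γ))) (s≤s⁻¹ h2)) h2)

    pbi-range : ∀ y → suc y ≤ n → 1 ≤ pbi j k ℓ (suc y) × pbi j k ℓ (suc y) ≤ n
    pbi-range y hy with region y
    ... | inC u h refl rewrite pbi-readsC {j} {k} {ℓ} |C| u h =
          s≤s z≤n , s≤s⁻¹ (≤-trans (+-monoʳ-< k (s≤s h)) ℓ≤n+1)
    ... | inB u h refl rewrite pbi-readsB {j} {k} {ℓ} |C| |B| u h =
          s≤s z≤n , s≤s⁻¹ (≤-trans (+-monoʳ-< j h) (≤-trans (m≤m+n k (suc γ)) ℓ≤n+1))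
    ... | inA u h refl rewrite pbi-readsA {j} {k} {ℓ} |C| |B| u
                                 (≤-trans (s≤s (s≤s (+-monoʳ-< (γ + β) (s≤s h)))) (≤-reflexive (posA-bound α β γ))) =
          s≤s z≤n , s≤s⁻¹ (≤-trans (s≤s (s≤s h)) (≤-trans (≤-trans (m≤m+n j β) (m≤m+n k (suc γ))) ℓ≤n+1))
    ... | inD y' refl h1 h2 rewrite pbi-fixesD {j} {k} {ℓ} |C| |B| y' h1 h2 = s≤s z≤n , hy

    perm-preserved : IsPerm n π → IsPerm n π'
    perm-preserved (range , inj) = range' , inj'
      where
      range' : ∀ i → 1 ≤ i → i ≤ n → (1 ≤ π' i × π' i ≤ n)
      range' (suc y) _ hy = range _ (proj₁ (pbi-range y hy)) (proj₂ (pbi-range y hy))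
      inj' : ∀ i i' → 1 ≤ i → i ≤ n → 1 ≤ i' → i' ≤ n → π' i ≡ π' i' → i ≡ i'
      inj' (suc y) (suc y') _ hy _ hy' eq =
        trans (sym (pbi-inverse y)) (trans (cong (pbi j⁻ k⁻ ℓ)
          (inj _ _ (proj₁ (pbi-range y hy)) (proj₂ (pbi-range y hy)) (proj₁ (pbi-range y' hy')) (proj₂ (pbi-range y' hy')) eq))
          (pbi-inverse y'))

applyPBI : ℕ × ℕ × ℕ → (ℕ → ℕ) → ℕ → ℕ
applyPBI (j , k , ℓ) π x = π (pbi j k ℓ x)

record Move (n : ℕ) (π : ℕ → ℕ) (g : ℕ) : Set where
  constructor move
  field
    interchange : ℕ × ℕ × ℕ
    valid : ValidPBI n interchange
    result-perm : IsPerm n (applyPBI interchange π)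
    gain : g + b n (applyPBI interchange π) ≤ b n π

  result : ℕ → ℕ
  result = applyPBI interchange π

weaken : ∀ {n π g} → Move n π (suc g) → Move n π g
weaken (move t v p gain) = move t v p (≤-trans (n≤1+n _) gain)

gain-from-count : ∀ {b' b o x} g → b' + o ≡ b + x → g + x ≤ o → g + b' ≤ b
gain-from-count {b'} {b} {o} {x} g count g+x≤o = +-cancelʳ-≤ x (g + b') b (begin
    g + b' + x   ≡⟨ trans (+-assoc g b' x) (trans (cong (g +_) (+-comm b' x)) (sym (+-assoc g x b'))) ⟩
    g + x + b'   ≤⟨ +-monoˡ-≤ b' g+x≤o ⟩
    o + b'       ≡⟨ +-comm o b' ⟩
    b' + o       ≡⟨ count ⟩
    b + x        ∎)
  where open ≤-Reasoning

-- Breakpoints of an interchange with B nonempty (|B| = β'+1) and |D| = δ: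
--   b(π') + [A|B] + [B|C] + [C|D] = b(π) + [C|B] + [B|A] + [A|D],
-- where [X|Y] is the breakpoint indicator at the junction of X and Y.
module InterchangeCount (n : ℕ) (π : ℕ → ℕ) (α β' γ δ : ℕ) where
  open Interchange n π α (suc β') γ public

  module _ (ℓ+δ≡n+1 : ℓ + δ ≡ suc n) where
    ℓ≤n+1 : ℓ ≤ suc n
    ℓ≤n+1 = ≤-trans (m≤m+n ℓ δ) (≤-reflexive ℓ+δ≡n+1)

    endC endA' : ℕ
    endC = suc (j + β') + γ
    endA' = suc (suc (suc γ) + β') + α

    oldAB oldBC oldCD newCB newBA newAD : ℕ
    oldAB = brk (E (suc α)) (E (suc (suc α)))
    oldBC = brk (E (j + β')) (E (suc (j + β')))
    oldCD = brk (E endC) (E (suc endC))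
    newCB = brk (E' (suc γ)) (E' (suc (suc γ)))
    newBA = brk (E' (suc (suc γ) + β')) (E' (suc (suc (suc γ) + β')))
    newAD = brk (E' endA') (E' (suc endA'))

    old-split : brks E 1 n ≡
      brks E 1 α + (oldAB + (brks E j β' + (oldBC + (brks E (suc (j + β')) γ + (oldCD + brks E (suc endC) δ)))))
    old-split = begin
        brks E 1 n
      ≡⟨ cong (brks E 1) n≡ABCD ⟩
        brks E 1 (α + suc (β' + suc (γ + suc δ)))
      ≡⟨ brks-split E 1 α _ ⟩
        brks E 1 α + (oldAB + brks E j (β' + suc (γ + suc δ)))
      ≡⟨ cong (λ z → brks E 1 α + (oldAB + z)) (brks-split E j β' _) ⟩
        brks E 1 α + (oldAB + (brks E j β' + (oldBC + brks E (suc (j + β')) (γ + suc δ))))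
      ≡⟨ cong (λ z → brks E 1 α + (oldAB + (brks E j β' + (oldBC + z)))) (brks-split E (suc (j + β')) γ _) ⟩
        brks E 1 α + (oldAB + (brks E j β' + (oldBC + (brks E (suc (j + β')) γ + (oldCD + brks E (suc endC) δ))))) ∎
      where open ≡-Reasoning
            lengths : ∀ α β' γ δ → suc (suc α) + suc β' + suc γ + δ ≡ suc (α + suc (β' + suc (γ + suc δ)))
            lengths = solve-∀
            n≡ABCD : n ≡ α + suc (β' + suc (γ + suc δ))
            n≡ABCD = suc-injective (trans (sym ℓ+δ≡n+1) (lengths α β' γ δ))

    new-split : brks E' 1 n ≡
      brks E' 1 γ + (newCB + (brks E' (suc (suc γ)) β' + (newBA + (brks E' (suc (suc (suc γ) + β')) α + (newAD + brks E' (suc endA') δ)))))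
    new-split = begin
        brks E' 1 n
      ≡⟨ cong (brks E' 1) n≡CBAD ⟩
        brks E' 1 (γ + suc (β' + suc (α + suc δ)))
      ≡⟨ brks-split E' 1 γ _ ⟩
        brks E' 1 γ + (newCB + brks E' (suc (suc γ)) (β' + suc (α + suc δ)))
      ≡⟨ cong (λ z → brks E' 1 γ + (newCB + z)) (brks-split E' (suc (suc γ)) β' _) ⟩
        brks E' 1 γ + (newCB + (brks E' (suc (suc γ)) β' + (newBA + brks E' (suc (suc (suc γ) + β')) (α + suc δ))))
      ≡⟨ cong (λ z → brks E' 1 γ + (newCB + (brks E' (suc (suc γ)) β' + (newBA + z)))) (brks-split E' (suc (suc (suc γ) + β')) α _) ⟩
        brks E' 1 γ + (newCB + (brks E' (suc (suc γ)) β' + (newBA + (brks E' (suc (suc (suc γ) + β')) α + (newAD + brks E' (suc endA') δ))))) ∎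
      where open ≡-Reasoning
            lengths : ∀ α β' γ δ → suc (suc α) + suc β' + suc γ + δ ≡ suc (γ + suc (β' + suc (α + suc δ)))
            lengths = solve-∀
            n≡CBAD : n ≡ γ + suc (β' + suc (α + suc δ))
            n≡CBAD = suc-injective (trans (sym ℓ+δ≡n+1) (lengths α β' γ δ))

    private
      posA : ∀ γ β' u → suc (suc (suc γ) + β') + u ≡ suc (suc γ + suc β' + u)
      posA = solve-∀
      endA'+1 : ∀ α β' γ → suc (suc (suc (suc γ) + β') + α) ≡ suc (suc α) + suc β' + suc γ
      endA'+1 = solve-∀
      endC+1 : ∀ α β' γ → suc (suc (suc (suc α) + β') + γ) ≡ suc (suc α) + suc β' + suc γ
      endC+1 = solve-∀

    sameC : brks E' 1 γ ≡ brks E (suc (j + β')) γ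
    sameC = brks-shift E E' (suc (j + β')) 1 γ (λ u h → trans (E'-C ℓ≤n+1 u h) (cong (λ z → E (z + u)) (+-suc j β')))
    sameB : brks E' (suc (suc γ)) β' ≡ brks E j β'
    sameB = brks-shift E E' j (suc (suc γ)) β' (λ u h → E'-B ℓ≤n+1 u (s≤s h))
    sameA : brks E' (suc (suc (suc γ) + β')) α ≡ brks E 1 α
    sameA = brks-shift E E' 1 (suc (suc (suc γ) + β')) α (λ u h → trans (cong E' (posA γ β' u)) (E'-A ℓ≤n+1 u h))
    sameD : brks E' (suc endA') δ ≡ brks E (suc endC) δ
    sameD = brks-shift E E' (suc endC) (suc endA') δ (λ u h →
              trans (cong (λ z → E' (z + u)) (endA'+1 α β' γ))
             (trans (E'-D ℓ≤n+1 u (≤-trans (+-monoʳ-≤ ℓ h) (≤-reflexive ℓ+δ≡n+1)))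
                    (cong (λ z → E (z + u)) (sym (endC+1 α β' γ)))))

    newCB≡ : newCB ≡ brk (E (k + γ)) (E j)
    newCB≡ = cong₂ brk (E'-C ℓ≤n+1 γ ≤-refl)
               (trans (cong (λ z → E' (suc z)) (sym (+-identityʳ (suc γ))))
               (trans (E'-B ℓ≤n+1 0 (s≤s z≤n)) (cong E (+-identityʳ j))))
    newBA≡ : newBA ≡ brk (E (j + β')) (E 1)
    newBA≡ = cong₂ brk (E'-B ℓ≤n+1 β' ≤-refl) (trans (cong E' (trans (sym (+-identityʳ _)) (posA γ β' 0))) (E'-A ℓ≤n+1 0 z≤n))
    newAD≡ : newAD ≡ brk (E (suc α)) (E ℓ)
    newAD≡ = cong₂ brk (trans (cong E' (posA γ β' α)) (E'-A ℓ≤n+1 α ≤-refl))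
               (trans (cong E' (endA'+1 α β' γ))
               (trans (cong E' (sym (+-identityʳ ℓ)))
               (trans (E'-D ℓ≤n+1 0 (≤-trans (≤-reflexive (+-identityʳ ℓ)) ℓ≤n+1)) (cong E (+-identityʳ ℓ)))))

    interchange-count : b n π' + (oldAB + oldBC + oldCD) ≡
      b n π + (brk (E (k + γ)) (E j) + brk (E (j + β')) (E 1) + brk (E (suc α)) (E ℓ))
    interchange-count = begin
        b n π' + (oldAB + oldBC + oldCD)
      ≡⟨ cong (_+ (oldAB + oldBC + oldCD)) (trans (countBP≡1+brks n π' n) (cong suc (trans new-split
           (cong₂ _+_ sameC (cong (newCB +_) (cong₂ _+_ sameB (cong (newBA +_) (cong₂ _+_ sameA (cong (newAD +_) sameD))))))))) ⟩
        suc (cC + (newCB + (cB + (newBA + (cA + (newAD + cD)))))) + (oldAB + oldBC + oldCD)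
      ≡⟨ regroup cA cB cC cD oldAB oldBC oldCD newCB newBA newAD ⟩
        suc (cA + (oldAB + (cB + (oldBC + (cC + (oldCD + cD)))))) + (newCB + newBA + newAD)
      ≡⟨ cong₂ _+_ (sym (trans (countBP≡1+brks n π n) (cong suc old-split))) (cong₂ _+_ (cong₂ _+_ newCB≡ newBA≡) newAD≡) ⟩
        b n π + (brk (E (k + γ)) (E j) + brk (E (j + β')) (E 1) + brk (E (suc α)) (E ℓ)) ∎
      where open ≡-Reasoning
            cA cB cC cD : ℕ
            cA = brks E 1 α
            cB = brks E j β'
            cC = brks E (suc (j + β')) γ
            cD = brks E (suc endC) δ
            regroup : ∀ A B C D o1 o2 o3 n1 n2 n3 →
              suc (C + (n1 + (B + (n2 + (A + (n3 + D)))))) + (o1 + o2 + o3) ≡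
              suc (A + (o1 + (B + (o2 + (C + (o3 + D)))))) + (n1 + n2 + n3)
            regroup = solve-∀

    interchange-move : IsPerm n π → oldAB ≡ 1 → oldBC ≡ 1 → oldCD ≡ 1 →
      brk (E (j + β')) (E 1) ≡ 0 → brk (E (suc α)) (E ℓ) ≡ 0 → Move n π 2
    interchange-move P ab bc cd ba ad =
      move (j , k , ℓ) (valid ℓ≤n+1) (PreservesPerm.perm-preserved n π α (suc β') γ ℓ≤n+1 P)
        (gain-from-count 2 count (+-monoʳ-≤ 2 (≤-trans (≤-reflexive (trans (+-identityʳ _) (+-identityʳ cb))) (brk≤1 _ _))))
      where
      cb : ℕ
      cb = brk (E (k + γ)) (E j)
      count : b n π' + (1 + 1 + 1) ≡ b n π + (cb + 0 + 0)
      count = trans (cong (b n π' +_) (sym (cong₂ _+_ (cong₂ _+_ ab bc) cd)))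
                (trans interchange-count (cong (b n π +_) (cong₂ _+_ (cong (cb +_) ba) ad)))

-- Breakpoints of a transposition of adjacent blocks (B empty):
--   b(π') + [A|C] + [C|D] = b(π) + [C|A] + [A|D].
module TranspositionCount (n : ℕ) (π : ℕ → ℕ) (α γ δ : ℕ) where
  open Interchange n π α 0 γ public

  module _ (ℓ+δ≡n+1 : ℓ + δ ≡ suc n) where
    ℓ≤n+1 : ℓ ≤ suc n
    ℓ≤n+1 = ≤-trans (m≤m+n ℓ δ) (≤-reflexive ℓ+δ≡n+1)

    endC endA' : ℕ
    endC = suc (suc α) + γ
    endA' = suc (suc γ) + α

    oldAC oldCD newCA newAD : ℕ
    oldAC = brk (E (suc α)) (E (suc (suc α)))
    oldCD = brk (E endC) (E (suc endC))
    newCA = brk (E' (suc γ)) (E' (suc (suc γ)))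
    newAD = brk (E' endA') (E' (suc endA'))

    old-split : brks E 1 n ≡ brks E 1 α + (oldAC + (brks E (suc (suc α)) γ + (oldCD + brks E (suc endC) δ)))
    old-split = begin
        brks E 1 n
      ≡⟨ cong (brks E 1) n≡ACD ⟩
        brks E 1 (α + suc (γ + suc δ))
      ≡⟨ brks-split E 1 α _ ⟩
        brks E 1 α + (oldAC + brks E (suc (suc α)) (γ + suc δ))
      ≡⟨ cong (λ z → brks E 1 α + (oldAC + z)) (brks-split E (suc (suc α)) γ _) ⟩
        brks E 1 α + (oldAC + (brks E (suc (suc α)) γ + (oldCD + brks E (suc endC) δ))) ∎
      where open ≡-Reasoning
            lengths : ∀ α γ δ → suc (suc α) + 0 + suc γ + δ ≡ suc (α + suc (γ + suc δ))
            lengths = solve-∀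
            n≡ACD : n ≡ α + suc (γ + suc δ)
            n≡ACD = suc-injective (trans (sym ℓ+δ≡n+1) (lengths α γ δ))

    new-split : brks E' 1 n ≡ brks E' 1 γ + (newCA + (brks E' (suc (suc γ)) α + (newAD + brks E' (suc endA') δ)))
    new-split = begin
        brks E' 1 n
      ≡⟨ cong (brks E' 1) n≡CAD ⟩
        brks E' 1 (γ + suc (α + suc δ))
      ≡⟨ brks-split E' 1 γ _ ⟩
        brks E' 1 γ + (newCA + brks E' (suc (suc γ)) (α + suc δ))
      ≡⟨ cong (λ z → brks E' 1 γ + (newCA + z)) (brks-split E' (suc (suc γ)) α _) ⟩
        brks E' 1 γ + (newCA + (brks E' (suc (suc γ)) α + (newAD + brks E' (suc endA') δ))) ∎
      where open ≡-Reasoning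
            lengths : ∀ α γ δ → suc (suc α) + 0 + suc γ + δ ≡ suc (γ + suc (α + suc δ))
            lengths = solve-∀
            n≡CAD : n ≡ γ + suc (α + suc δ)
            n≡CAD = suc-injective (trans (sym ℓ+δ≡n+1) (lengths α γ δ))

    private
      posA : ∀ γ u → suc (suc γ) + u ≡ suc (suc γ + 0 + u)
      posA = solve-∀
      endA'+1 : ∀ α γ → suc (suc (suc γ) + α) ≡ suc (suc α) + 0 + suc γ
      endA'+1 = solve-∀
      endC+1 : ∀ α γ → suc (suc (suc α) + γ) ≡ suc (suc α) + 0 + suc γ
      endC+1 = solve-∀

    sameC : brks E' 1 γ ≡ brks E (suc (suc α)) γ
    sameC = brks-shift E E' (suc (suc α)) 1 γ (λ u h → trans (E'-C ℓ≤n+1 u h) (cong (λ z → E (z + u)) (+-identityʳ (suc (suc α)))))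
    sameA : brks E' (suc (suc γ)) α ≡ brks E 1 α
    sameA = brks-shift E E' 1 (suc (suc γ)) α (λ u h → trans (cong E' (posA γ u)) (E'-A ℓ≤n+1 u h))
    sameD : brks E' (suc endA') δ ≡ brks E (suc endC) δ
    sameD = brks-shift E E' (suc endC) (suc endA') δ (λ u h →
              trans (cong (λ z → E' (z + u)) (endA'+1 α γ))
             (trans (E'-D ℓ≤n+1 u (≤-trans (+-monoʳ-≤ ℓ h) (≤-reflexive ℓ+δ≡n+1)))
                    (cong (λ z → E (z + u)) (sym (endC+1 α γ)))))

    newCA≡ : newCA ≡ brk (E (k + γ)) (E 1)
    newCA≡ = cong₂ brk (E'-C ℓ≤n+1 γ ≤-refl) (trans (cong E' (trans (sym (+-identityʳ _)) (posA γ 0))) (E'-A ℓ≤n+1 0 z≤n))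
    newAD≡ : newAD ≡ brk (E (suc α)) (E ℓ)
    newAD≡ = cong₂ brk (trans (cong E' (posA γ α)) (E'-A ℓ≤n+1 α ≤-refl))
               (trans (cong E' (endA'+1 α γ))
               (trans (cong E' (sym (+-identityʳ ℓ)))
               (trans (E'-D ℓ≤n+1 0 (≤-trans (≤-reflexive (+-identityʳ ℓ)) ℓ≤n+1)) (cong E (+-identityʳ ℓ)))))

    transposition-count : b n π' + (oldAC + oldCD) ≡ b n π + (brk (E (k + γ)) (E 1) + brk (E (suc α)) (E ℓ))
    transposition-count = begin
        b n π' + (oldAC + oldCD)
      ≡⟨ cong (_+ (oldAC + oldCD)) (trans (countBP≡1+brks n π' n) (cong suc (trans new-split
           (cong₂ _+_ sameC (cong (newCA +_) (cong₂ _+_ sameA (cong (newAD +_) sameD))))))) ⟩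
        suc (cC + (newCA + (cA + (newAD + cD)))) + (oldAC + oldCD)
      ≡⟨ regroup cA cC cD oldAC oldCD newCA newAD ⟩
        suc (cA + (oldAC + (cC + (oldCD + cD)))) + (newCA + newAD)
      ≡⟨ cong₂ _+_ (sym (trans (countBP≡1+brks n π n) (cong suc old-split))) (cong₂ _+_ newCA≡ newAD≡) ⟩
        b n π + (brk (E (k + γ)) (E 1) + brk (E (suc α)) (E ℓ)) ∎
      where open ≡-Reasoning
            cA cC cD : ℕ
            cA = brks E 1 α
            cC = brks E (suc (suc α)) γ
            cD = brks E (suc endC) δ
            regroup : ∀ A C D o1 o3 n1 n3 →
              suc (C + (n1 + (A + (n3 + D)))) + (o1 + o3) ≡ suc (A + (o1 + (C + (o3 + D)))) + (n1 + n3)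
            regroup = solve-∀

    -- If [A|C] and [C|D] are breakpoints and [A|D] becomes an adjacency, the
    -- transposition removes 1 + (1 − [C|A]) breakpoints.
    transposition-move : ∀ g → g + brk (E (k + γ)) (E 1) ≤ 2 → IsPerm n π →
      oldAC ≡ 1 → oldCD ≡ 1 → brk (E (suc α)) (E ℓ) ≡ 0 → Move n π g
    transposition-move g g+ca≤2 P ac cd ad =
      move (j , k , ℓ) (valid ℓ≤n+1) (PreservesPerm.perm-preserved n π α 0 γ ℓ≤n+1 P)
        (gain-from-count g count (≤-trans (≤-reflexive (cong (g +_) (+-identityʳ ca))) g+ca≤2))
      where
      ca : ℕ
      ca = brk (E (k + γ)) (E 1)
      count : b n π' + (1 + 1) ≡ b n π + (ca + 0)
      count = trans (cong (b n π' +_) (sym (cong₂ _+_ ac cd)))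
                (trans transposition-count (cong (b n π +_) (cong (ca +_) ad)))

-- Every value of [1,n] occurs in a permutation of [n]: if v were missed, the
-- n positions would be mapped injectively into the n−1 remaining values.
value-has-position : ∀ n π → IsPerm n π → ∀ v → 1 ≤ v → v ≤ n →
  Σ ℕ λ p → 1 ≤ p × p ≤ n × π p ≡ v
value-has-position n π (range , inj) v _ v≤n
  with any? (λ (i : Fin n) → π (suc (toℕ i)) ≟ v)
... | yes (i , πi≡v) = suc (toℕ i) , s≤s z≤n , toℕ<n i , πi≡v
value-has-position (suc m) π (range , inj) (suc v) _ v≤n | no missing =
  ⊥-elim (1+n≰n (injective⇒≤ {f = squeeze} squeeze-injective))
  where
  value : Fin (suc m) → ℕ
  value i = π (suc (toℕ i))
  positive : ∀ i → 1 ≤ value i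
  positive i = proj₁ (range (suc (toℕ i)) (s≤s z≤n) (toℕ<n i))
  pred-value< : ∀ i → pred (value i) < suc m
  pred-value< i with value i | range (suc (toℕ i)) (s≤s z≤n) (toℕ<n i)
  ... | suc w | _ , w<1+m = w<1+m
  slot : Fin (suc m) → Fin (suc m)
  slot i = fromℕ< (pred-value< i)
  toℕ-slot : ∀ i → toℕ (slot i) ≡ pred (value i)
  toℕ-slot i = toℕ-fromℕ< (pred-value< i)
  slot-injective : ∀ i i' → slot i ≡ slot i' → i ≡ i'
  slot-injective i i' eq = toℕ-injective (suc-injective (inj _ _ (s≤s z≤n) (toℕ<n i) (s≤s z≤n) (toℕ<n i')
    (pred-injective {{>-nonZero (positive i)}} {{>-nonZero (positive i')}} (trans (sym (toℕ-slot i)) (trans (cong toℕ eq) (toℕ-slot i'))))))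
  missed : Fin (suc m)
  missed = fromℕ< v≤n
  missed≢slot : ∀ i → missed ≢ slot i
  missed≢slot i eq = missing (i , pred-injective {{>-nonZero (positive i)}}
    (trans (sym (toℕ-slot i)) (trans (cong toℕ (sym eq)) (toℕ-fromℕ< v≤n))))
  squeeze : Fin (suc m) → Fin m
  squeeze i = punchOut (missed≢slot i)
  squeeze-injective : ∀ {i i'} → squeeze i ≡ squeeze i' → i ≡ i'
  squeeze-injective {i} {i'} eq = slot-injective i i' (punchOut-injective (missed≢slot i) (missed≢slot i') eq)

ext-distinct : ∀ n π → IsPerm n π → ∀ {p q} → 1 ≤ p → p ≤ suc n → 1 ≤ q → q ≤ suc n →
  p ≢ q → ext n π p ≢ ext n π q
ext-distinct n π (range , inj) {p} {q} 1≤p p≤n+1 1≤q q≤n+1 p≢q eq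
  with m≤n⇒m<n∨m≡n p≤n+1 | m≤n⇒m<n∨m≡n q≤n+1
... | inj₂ refl | inj₂ refl = p≢q refl
... | inj₁ (s≤s p≤n) | inj₁ (s≤s q≤n) =
  p≢q (inj p q 1≤p p≤n 1≤q q≤n (trans (sym (ext-position n π p 1≤p p≤n)) (trans eq (ext-position n π q 1≤q q≤n))))
... | inj₁ (s≤s p≤n) | inj₂ refl =
  1+n≰n (subst (_≤ n) (trans (sym (ext-position n π p 1≤p p≤n)) (trans eq (ext-top n π))) (proj₂ (range p 1≤p p≤n)))
... | inj₂ refl | inj₁ (s≤s q≤n) =
  1+n≰n (subst (_≤ n) (trans (sym (ext-position n π q 1≤q q≤n)) (trans (sym eq) (ext-top n π))) (proj₂ (range q 1≤q q≤n)))

crossing : (Q : ℕ → Set) → (∀ x → Dec (Q x)) → ∀ lo d → Q lo → ¬ Q (lo + d) →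
  Σ ℕ λ v → lo ≤ v × v < lo + d × Q v × ¬ Q (suc v)
crossing Q Q? lo zero q nq = ⊥-elim (nq (subst Q (sym (+-identityʳ lo)) q))
crossing Q Q? lo (suc d) q nq with Q? (suc lo)
... | no nq1 = lo , ≤-refl , m<m+n lo (s≤s z≤n) , q , nq1
... | yes q1 with crossing Q Q? (suc lo) d q1 (λ z → nq (subst Q (sym (+-suc lo d)) z))
... | v , lo<v , v<lo+d , qv , nqv = v , ≤-trans (n≤1+n lo) lo<v , ≤-trans v<lo+d (≤-reflexive (sym (+-suc lo d))) , qv , nqv

-- The 2-move when e+1 directly follows a (ℓ = r+1, p = α+1, r = p+γ+1):
-- transposing A = [1,p] and (p,r] joins (a , a+1) and (e , e+1).
two-gain-transposition : ∀ n π → IsPerm n π → ∀ a e α γ δ → suc a ≤ e →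
  suc (suc α + suc γ) + δ ≡ suc n →
  ext n π 1 ≡ suc a → ext n π (suc α + suc γ) ≡ a → ext n π (suc α) ≡ e → ext n π (suc (suc α + suc γ)) ≡ suc e →
  Move n π 2
two-gain-transposition n π P a e α γ δ a<e r+1+δ≡n+1 E1 Er Ep Er+1 =
  transposition-move ℓ+δ≡n+1 2 (≤-reflexive (cong (2 +_) ca)) P ac cd ad
  where
  open TranspositionCount n π α γ δ
  ℓ≡r+1 : ℓ ≡ suc (suc α + suc γ)
  ℓ≡r+1 = cong (λ x → suc (x + suc γ)) (+-identityʳ (suc α))
  ℓ+δ≡n+1 : ℓ + δ ≡ suc n
  ℓ+δ≡n+1 = trans (cong (_+ δ) ℓ≡r+1) r+1+δ≡n+1
  endC≡r : endC ℓ+δ≡n+1 ≡ suc α + suc γ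
  endC≡r = sym (+-suc (suc α) γ)
  α+2<ℓ : suc (suc α) < ℓ
  α+2<ℓ = subst (suc (suc α) <_) (sym ℓ≡r+1) (s≤s (s≤s (≤-trans (≤-reflexive (+-comm 1 α)) (+-monoʳ-≤ α (s≤s z≤n)))))
  ac : oldAC ℓ+δ≡n+1 ≡ 1
  ac = brk-gap Ep refl (λ eq → ext-distinct n π P (s≤s z≤n) (≤-trans (<⇒≤ α+2<ℓ) (ℓ≤n+1 ℓ+δ≡n+1))
         (s≤s z≤n) (ℓ≤n+1 ℓ+δ≡n+1) (<⇒≢ α+2<ℓ) (trans eq (sym (trans (cong E ℓ≡r+1) Er+1))))
  cd : oldCD ℓ+δ≡n+1 ≡ 1
  cd = brk-gap (trans (cong E endC≡r) Er) (trans (cong (λ x → E (suc x)) endC≡r) Er+1)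
         (λ eq → <⇒≢ a<e (sym (suc-injective eq)))
  ca : brk (E (k + γ)) (E 1) ≡ 0
  ca = brk-adjacent (trans (cong (λ x → E (x + γ)) (+-identityʳ (suc (suc α)))) (trans (cong E endC≡r) Er)) E1
  ad : brk (E (suc α)) (E ℓ) ≡ 0
  ad = brk-adjacent Ep (trans (cong E ℓ≡r+1) Er+1)

-- The 2-move otherwise (p = α+1, r = p+β'+1, ℓ = r+γ+2): interchanging
-- A = [1,p] and C = (r,ℓ) around B = (p,r] joins (a , a+1) and (e , e+1).
two-gain-interchange : ∀ n π → IsPerm n π → ∀ a e α β' γ δ → suc a ≤ e →
  suc (suc α + suc β') + suc γ + δ ≡ suc n →
  ext n π 1 ≡ suc a → ext n π (suc α + suc β') ≡ a → ext n π (suc α) ≡ e →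
  ext n π (suc (suc α + suc β') + suc γ) ≡ suc e →
  Move n π 2
two-gain-interchange n π P a e α β' γ δ a<e ℓ+δ≡n+1 E1 Er Ep Eℓ =
  interchange-move ℓ+δ≡n+1 P ab bc cd ba ad
  where
  open InterchangeCount n π α β' γ δ
  r≡ : j + β' ≡ suc α + suc β'
  r≡ = cong suc (sym (+-suc α β'))
  endC+1≡ℓ : suc (endC ℓ+δ≡n+1) ≡ ℓ
  endC+1≡ℓ = shape α β' γ
    where shape : ∀ α β' γ → suc (suc (suc (suc α) + β') + γ) ≡ suc (suc α) + suc β' + suc γ
          shape = solve-∀
  ℓ≤ : ℓ ≤ suc n
  ℓ≤ = ℓ≤n+1 ℓ+δ≡n+1
  distinct : ∀ {p q} → 1 ≤ p → p < ℓ → 1 ≤ q → q ≤ ℓ → p ≢ q → E p ≢ E q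
  distinct 1≤p p<ℓ 1≤q q≤ℓ = ext-distinct n π P 1≤p (≤-trans (<⇒≤ p<ℓ) ℓ≤) 1≤q (≤-trans q≤ℓ ℓ≤)
  α+1<endC : suc α < endC ℓ+δ≡n+1
  α+1<endC = s≤s (s≤s (≤-trans (m≤m+n α β') (≤-trans (m≤m+n (α + β') γ) (n≤1+n _))))
  α+2<ℓ : suc (suc α) < ℓ
  α+2<ℓ = ≤-trans (s≤s (s≤s (s≤s (≤-trans (m≤m+n α β') (≤-trans (m≤m+n (α + β') γ) (n≤1+n _))))))
            (≤-reflexive endC+1≡ℓ)
  ab : oldAB ℓ+δ≡n+1 ≡ 1
  ab = brk-gap Ep refl (λ eq → distinct (s≤s z≤n) α+2<ℓ (s≤s z≤n) ≤-refl (<⇒≢ α+2<ℓ) (trans eq (sym Eℓ)))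
  bc : oldBC ℓ+δ≡n+1 ≡ 1
  bc = brk-gap (trans (cong E r≡) Er) refl
         (λ eq → distinct (s≤s z≤n) r+1<ℓ (s≤s z≤n) (s≤s z≤n) (λ ()) (trans eq (sym E1)))
    where r+1<ℓ : suc (j + β') < ℓ
          r+1<ℓ = ≤-trans (s≤s (≤-reflexive (sym (+-suc j β')))) (m<m+n k (s≤s z≤n))
  cd : oldCD ℓ+δ≡n+1 ≡ 1
  cd = brk-gap refl (trans (cong E endC+1≡ℓ) Eℓ)
         (λ eq → distinct (s≤s z≤n) (≤-reflexive endC+1≡ℓ) (s≤s z≤n) (≤-trans (n≤1+n _) (<⇒≤ α+2<ℓ))
                   (λ eq' → <⇒≢ α+1<endC (sym eq')) (trans (sym (suc-injective eq)) (sym Ep)))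
  ba : brk (E (j + β')) (E 1) ≡ 0
  ba = brk-adjacent (trans (cong E r≡) Er) E1
  ad : brk (E (suc α)) (E ℓ) ≡ 0
  ad = brk-adjacent Ep Eℓ

<-split : ∀ {m n} → m < n → Σ ℕ λ d → n ≡ m + suc d
<-split {m} m<n with m≤n⇒∃[o]m+o≡n m<n
... | d , refl = d , sym (+-suc m d)

two-gain-move-at : ∀ n π → IsPerm n π → ∀ a e p r ℓ → 1 ≤ p → p < r → r < ℓ → ℓ ≤ suc n → suc a ≤ e →
  ext n π 1 ≡ suc a → ext n π r ≡ a → ext n π p ≡ e → ext n π ℓ ≡ suc e → Move n π 2
two-gain-move-at n π P a e (suc α) r ℓ _ p<r r<ℓ ℓ≤n+1 a<e E1 Er Ep Eℓ
  with <-split p<r | m≤n⇒m<n∨m≡n r<ℓ | m≤n⇒∃[o]m+o≡n ℓ≤n+1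
... | γ , refl | inj₂ refl | δ , ℓ+δ≡n+1 =
  two-gain-transposition n π P a e α γ δ a<e ℓ+δ≡n+1 E1 Er Ep Eℓ
... | β' , refl | inj₁ r+1<ℓ | δ , ℓ+δ≡n+1 with <-split r+1<ℓ
...   | γ , refl = two-gain-interchange n π P a e α β' γ δ a<e ℓ+δ≡n+1 E1 Er Ep Eℓ

ext-has-position : ∀ n π → IsPerm n π → ∀ v → 1 ≤ v → v ≤ suc n →
  Σ ℕ λ ℓ → 1 ≤ ℓ × ℓ ≤ suc n × ext n π ℓ ≡ v
ext-has-position n π P v 1≤v v≤n+1 with m≤n⇒m<n∨m≡n v≤n+1
... | inj₂ refl = suc n , s≤s z≤n , ≤-refl , ext-top n π
... | inj₁ (s≤s v≤n) with value-has-position n π P v 1≤v v≤n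
...   | ℓ , 1≤ℓ , ℓ≤n , πℓ≡v = ℓ , 1≤ℓ , ≤-trans ℓ≤n (n≤1+n n) , trans (ext-position n π ℓ 1≤ℓ ℓ≤n) πℓ≡v

OccursBefore : ℕ → (ℕ → ℕ) → ℕ → ℕ → Set
OccursBefore n π r v = Σ ℕ λ p → p < r × 1 ≤ p × ext n π p ≡ v

occursBefore? : ∀ n π r v → Dec (OccursBefore n π r v)
occursBefore? n π r v = anyUpTo? (λ p → (1 ≤? p) ×-dec (ext n π p ≟ v)) r

-- If the value a+1 occurs before position r ≤ n, then some e > a occurs
-- before r while e+1 does not: the values occurring before r exclude n+1.
last-before : ∀ n π → IsPerm n π → ∀ r a → r ≤ n → suc a ≤ n → OccursBefore n π r (suc a) →
  Σ ℕ λ e → suc a ≤ e × e ≤ n × OccursBefore n π r e × ¬ OccursBefore n π r (suc e)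
last-before n π P r a r≤n a<n a+1-before with m≤n⇒∃[o]m+o≡n (≤-trans a<n (n≤1+n n))
... | d , a+1+d≡n+1 with crossing (OccursBefore n π r) (occursBefore? n π r) (suc a) d a+1-before not-n+1
  where
  not-n+1 : ¬ OccursBefore n π r (suc a + d)
  not-n+1 (p , p<r , 1≤p , Ep≡) =
    ext-distinct n π P 1≤p (≤-trans (<⇒≤ p<r) (≤-trans r≤n (n≤1+n n))) (s≤s z≤n) ≤-refl
      (λ p≡n+1 → 1+n≰n (≤-trans (≤-reflexive (sym p≡n+1)) (≤-trans (<⇒≤ p<r) r≤n)))
      (trans Ep≡ (trans a+1+d≡n+1 (sym (ext-top n π))))
... | e , a<e , e<a+1+d , e-before , e+1-not-before =
  e , a<e , s≤s⁻¹ (≤-trans e<a+1+d (≤-reflexive a+1+d≡n+1)) , e-before , e+1-not-before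

above-one : ∀ {x} → 1 ≤ x → x ≢ 1 → Σ ℕ λ a → x ≡ suc a × 1 ≤ a
above-one {suc (suc a)} _ _ = suc a , refl , s≤s z≤n
above-one {suc zero} _ x≢1 = ⊥-elim (x≢1 refl)

-- If π₁ = a+1 ≠ 1, some prefix interchange removes two breakpoints: a sits at
-- a position r > 1; take e from `last-before`, and e+1 then sits at ℓ > r.
two-gain-move : ∀ n π → IsPerm n π → 1 ≤ n → π 1 ≢ 1 → Move n π 2
two-gain-move n π P 1≤n π1≢1 with proj₁ P 1 ≤-refl 1≤n
... | 1≤π1 , π1≤n with above-one 1≤π1 π1≢1
... | a , π1≡a+1 , 1≤a with value-has-position n π P a 1≤a (≤-trans (n≤1+n a) (subst (_≤ n) π1≡a+1 π1≤n))
... | r , 1≤r , r≤n , πr≡a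
  with last-before n π P r a r≤n (subst (_≤ n) π1≡a+1 π1≤n) (1 , 1<r , ≤-refl , trans (ext-position n π 1 ≤-refl 1≤n) π1≡a+1)
  where
  1<r : 1 < r
  1<r = ≤∧≢⇒< 1≤r (λ 1≡r → 1+n≰n (≤-reflexive (trans (sym π1≡a+1) (trans (cong π 1≡r) πr≡a))))
... | e , a<e , e≤n , (p , p<r , 1≤p , Ep) , e+1-not-before
  with ext-has-position n π P (suc e) (s≤s z≤n) (s≤s e≤n)
... | ℓ , 1≤ℓ , ℓ≤n+1 , Eℓ = two-gain-move-at n π P a e p r ℓ 1≤p p<r r<ℓ ℓ≤n+1 a<e E1 Er Ep Eℓ
  where
  E1 : ext n π 1 ≡ suc a
  E1 = trans (ext-position n π 1 ≤-refl 1≤n) π1≡a+1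
  Er : ext n π r ≡ a
  Er = trans (ext-position n π r 1≤r r≤n) πr≡a
  r<ℓ : r < ℓ
  r<ℓ with <-cmp r ℓ
  ... | tri< r<ℓ _ _ = r<ℓ
  ... | tri≈ _ r≡ℓ _ = ⊥-elim (<⇒≢ (≤-trans a<e (n≤1+n e)) (trans (sym Er) (trans (cong (ext n π) r≡ℓ) Eℓ)))
  ... | tri> _ _ ℓ<r = ⊥-elim (e+1-not-before (ℓ , ℓ<r , 1≤ℓ , Eℓ))

FixedUpTo : (ℕ → ℕ) → ℕ → Set
FixedUpTo π x = ∀ {i} → i < x → π (suc i) ≡ suc i

fixedUpTo? : ∀ π x → Dec (FixedUpTo π x)
fixedUpTo? π x = allUpTo? (λ i → π (suc i) ≟ suc i) x

fixed⇒identity : ∀ n π → FixedUpTo π n → IsIdentity n π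
fixed⇒identity n π fixed (suc i) _ i<n = fixed i<n

first-unfixed : ∀ π v → FixedUpTo π v → ¬ FixedUpTo π (suc v) → π (suc v) ≢ suc v
first-unfixed π v fixed not-fixed πv+1≡v+1 = not-fixed fixed′
  where
  fixed′ : FixedUpTo π (suc v)
  fixed′ {i} (s≤s i≤v) with m≤n⇒m<n∨m≡n i≤v
  ... | inj₁ i<v = fixed i<v
  ... | inj₂ refl = πv+1≡v+1

-- The 1-move: if 1, …, α+1 are fixed, E(α+2) ≠ α+2 and α+2 sits at position
-- q = α+2+γ+1, transposing A = [1,α+1] and C = [α+2,q) joins (α+1 , α+2);
-- the new first entry π(α+2) differs from π₁ = 1.
one-gain-transposition : ∀ n π → IsPerm n π → ∀ α γ δ → suc (suc α) + suc γ + δ ≡ suc n → π 1 ≡ 1 →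
  ext n π (suc α) ≡ suc α → ext n π (suc (suc α)) ≢ suc (suc α) → ext n π (suc (suc α) + suc γ) ≡ suc (suc α) →
  Σ (Move n π 1) λ m → Move.result m 1 ≢ 1
one-gain-transposition n π P α γ δ q+δ≡n+1 π1≡1 Eα+1 Eα+2 Eq =
  transposition-move ℓ+δ≡n+1 1 (+-monoʳ-≤ 1 (brk≤1 _ _)) P ac cd ad , new-first≢1
  where
  open TranspositionCount n π α γ δ
  ℓ≡q : ℓ ≡ suc (suc α) + suc γ
  ℓ≡q = cong (_+ suc γ) (+-identityʳ (suc (suc α)))
  ℓ+δ≡n+1 : ℓ + δ ≡ suc n
  ℓ+δ≡n+1 = trans (cong (_+ δ) ℓ≡q) q+δ≡n+1
  ℓ≤ : ℓ ≤ suc n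
  ℓ≤ = ℓ≤n+1 ℓ+δ≡n+1
  endC+1≡q : suc (endC ℓ+δ≡n+1) ≡ suc (suc α) + suc γ
  endC+1≡q = sym (+-suc (suc (suc α)) γ)
  α+1<endC : suc α < endC ℓ+δ≡n+1
  α+1<endC = s≤s (s≤s (m≤m+n α γ))
  endC<ℓ : endC ℓ+δ≡n+1 < ℓ
  endC<ℓ = ≤-reflexive (trans endC+1≡q (sym ℓ≡q))
  ac : oldAC ℓ+δ≡n+1 ≡ 1
  ac = brk-gap Eα+1 refl Eα+2
  cd : oldCD ℓ+δ≡n+1 ≡ 1
  cd = brk-gap refl (trans (cong E endC+1≡q) Eq)
         (λ eq → ext-distinct n π P (s≤s z≤n) (≤-trans (<⇒≤ endC<ℓ) ℓ≤) (s≤s z≤n) (≤-trans (<⇒≤ (<-trans α+1<endC endC<ℓ)) ℓ≤)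
                   (λ eq' → <⇒≢ α+1<endC (sym eq')) (trans (sym (suc-injective eq)) (sym Eα+1)))
  ad : brk (E (suc α)) (E ℓ) ≡ 0
  ad = brk-adjacent Eα+1 (trans (cong E ℓ≡q) Eq)
  new-first≢1 : π' 1 ≢ 1
  k<ℓ : k + 0 < ℓ
  k<ℓ = ≤-trans (m<m+n (k + 0) (s≤s z≤n)) (≤-reflexive (cong (_+ suc γ) (+-identityʳ k)))
  new-first≢1 π'1≡1 = α+2≢1 (proj₂ P (k + 0) 1 (s≤s z≤n) (s≤s⁻¹ (≤-trans k<ℓ ℓ≤)) ≤-refl (≤-trans (s≤s z≤n) (s≤s⁻¹ (≤-trans k<ℓ ℓ≤)))
    (trans (sym (cong π (pbi-readsC {j} {k} {ℓ} |C| 0 z≤n))) (trans π'1≡1 (sym π1≡1))))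
    where α+2≢1 : ∀ {x} → suc (suc x) ≢ 1
          α+2≢1 ()

one-gain-move : ∀ n π → IsPerm n π → π 1 ≡ 1 → ¬ FixedUpTo π n → Σ (Move n π 1) λ m → Move.result m 1 ≢ 1
one-gain-move zero π P π1≡1 not-fixed = ⊥-elim (not-fixed (λ ()))
one-gain-move (suc d) π P π1≡1 not-fixed
  with crossing (FixedUpTo π) (fixedUpTo? π) 1 d (λ { (s≤s z≤n) → π1≡1 }) not-fixed
... | suc α , _ , α+1<n , fixed-α+1 , not-fixed-α+2
  with value-has-position (suc d) π P (suc (suc α)) (s≤s z≤n) α+1<n
... | q , 1≤q , q≤n , πq with <-cmp (suc (suc α)) q
... | tri≈ _ α+2≡q _ = ⊥-elim (first-unfixed π (suc α) fixed-α+1 not-fixed-α+2 (trans (cong π α+2≡q) πq))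
... | tri> _ _ q<α+2 = ⊥-elim (<⇒≢ q<α+2 (trans (sym (fixed-q q<α+2 1≤q)) πq))
  where
  fixed-q : ∀ {q} → q < suc (suc α) → 1 ≤ q → π q ≡ q
  fixed-q {suc i} (s≤s i<α+1) _ = fixed-α+1 i<α+1
... | tri< α+2<q _ _ with <-split α+2<q | m≤n⇒∃[o]m+o≡n (≤-trans q≤n (n≤1+n (suc d)))
... | γ , refl | δ , q+δ≡n+1 =
  one-gain-transposition (suc d) π P α γ δ q+δ≡n+1 π1≡1 Eα+1 Eα+2 (trans (ext-position (suc d) π _ 1≤q q≤n) πq)
  where
  Eα+1 : ext (suc d) π (suc α) ≡ suc α
  Eα+1 = trans (ext-position (suc d) π (suc α) (s≤s z≤n) (≤-trans (n≤1+n _) α+1<n)) (fixed-α+1 {α} ≤-refl)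
  Eα+2 : ext (suc d) π (suc (suc α)) ≢ suc (suc α)
  Eα+2 eq = first-unfixed π (suc α) fixed-α+1 not-fixed-α+2 (trans (sym (ext-position (suc d) π _ (s≤s z≤n) α+1<n)) eq)

data Progress (n : ℕ) (π : ℕ → ℕ) : Set where
  sorted-by-one : (m : Move n π 1) → IsIdentity n (Move.result m) → Progress n π
  three-by-two : ∀ {g₁ g₂} (m₁ : Move n π g₁) → Move n (Move.result m₁) g₂ → 3 ≤ g₁ + g₂ → Progress n π

some-move : ∀ n π → IsPerm n π → 1 ≤ n → ¬ FixedUpTo π n → Move n π 1
some-move n π P 1≤n not-fixed with π 1 ≟ 1
... | yes π1≡1 = proj₁ (one-gain-move n π P π1≡1 not-fixed)
... | no π1≢1 = weaken (two-gain-move n π P 1≤n π1≢1)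

after-two-gain : ∀ n π → 1 ≤ n → Move n π 2 → Progress n π
after-two-gain n π 1≤n m₁ with fixedUpTo? (Move.result m₁) n
... | yes sorted = sorted-by-one (weaken m₁) (fixed⇒identity n _ sorted)
... | no not-sorted = three-by-two m₁ (some-move n (Move.result m₁) (Move.result-perm m₁) 1≤n not-sorted) ≤-refl

-- If π₁ = 1, a 1-move is followed by a 2-move; otherwise start with a 2-move.
progress : ∀ n π → IsPerm n π → 1 ≤ n → ¬ FixedUpTo π n → Progress n π
progress n π P 1≤n not-fixed with π 1 ≟ 1
... | no π1≢1 = after-two-gain n π 1≤n (two-gain-move n π P 1≤n π1≢1)
... | yes π1≡1 with one-gain-move n π P π1≡1 not-fixed
...   | m₁ , first≢1 = three-by-two m₁ (two-gain-move n (Move.result m₁) (Move.result-perm m₁) 1≤n first≢1) ≤-refl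

gain-of-two-moves : ∀ {n π g₁ g₂} (m₁ : Move n π g₁) (m₂ : Move n (Move.result m₁) g₂) →
  3 ≤ g₁ + g₂ → 3 + b n (Move.result m₂) ≤ b n π
gain-of-two-moves {n} {π} {g₁} {g₂} m₁ m₂ 3≤g = begin
    3 + b n (Move.result m₂)          ≤⟨ +-monoˡ-≤ _ 3≤g ⟩
    g₁ + g₂ + b n (Move.result m₂)    ≡⟨ +-assoc g₁ g₂ _ ⟩
    g₁ + (g₂ + b n (Move.result m₂))  ≤⟨ +-monoʳ-≤ g₁ (Move.gain m₂) ⟩
    g₁ + b n (Move.result m₁)         ≤⟨ Move.gain m₁ ⟩
    b n π                             ∎
  where open ≤-Reasoning

sortable-cons : ∀ n π t m → ValidPBI n t → SortableIn n (applyPBI t π) m → SortableIn n π (suc m)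
sortable-cons n π (j , k , ℓ) m valid (βs , length≡m , all-valid , sorted) =
  ((j , k , ℓ) ∷ βs) , cong suc length≡m , valid ∷ all-valid , sorted

-- The bound 2⌈(B−1)/3⌉ of the theorem, written as 2 ⌊(B−1+2)/3⌋.
bound : ℕ → ℕ
bound B = 2 * ((B ∸ 1 + 2) / 3)

/3-step : ∀ x → (x + 3) / 3 ≡ x / 3 + 1
/3-step x = +-distrib-/-∣ʳ x (∣-refl {3})

bound-one-move : ∀ B → 2 ≤ B → 1 ≤ bound B
bound-one-move (suc zero) (s≤s ())
bound-one-move (suc (suc B)) _ = ≤-trans (≤-trans (m≤n+m 1 (B / 3)) (≤-reflexive (sym (trans (cong (_/ 3) (shift B)) (/3-step B)))))
  (m≤m+n _ _)
  where shift : ∀ B → suc B + 2 ≡ B + 3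
        shift = solve-∀

-- removing three breakpoints pays for two moves
bound-two-moves : ∀ B B₂ t → 1 ≤ B₂ → B₂ + 3 ≤ B → t ≤ bound B₂ → 2 + t ≤ bound B
bound-two-moves B (suc B₂) t _ B₂+3≤B t≤ = begin
    2 + t                         ≤⟨ +-monoʳ-≤ 2 t≤ ⟩
    2 + 2 * ((B₂ + 2) / 3)        ≡⟨ sym (*-distribˡ-+ 2 1 ((B₂ + 2) / 3)) ⟩
    2 * (1 + (B₂ + 2) / 3)        ≡⟨ cong (2 *_) (trans (+-comm 1 _) (sym (/3-step (B₂ + 2)))) ⟩
    2 * ((B₂ + 2 + 3) / 3)        ≤⟨ *-monoʳ-≤ 2 (/-monoˡ-≤ 3 (≤-trans (≤-reflexive (swap B₂)) (+-monoˡ-≤ 2 B₂+3≤B-1))) ⟩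
    bound B                       ∎
  where open ≤-Reasoning
        swap : ∀ B₂ → B₂ + 2 + 3 ≡ B₂ + 3 + 2
        swap = solve-∀
        B₂+3≤B-1 : B₂ + 3 ≤ B ∸ 1
        B₂+3≤B-1 = ≤-trans (≤-reflexive (sym (m+n∸n≡m (B₂ + 3) 1)))
                     (∸-monoˡ-≤ 1 (≤-trans (≤-reflexive (+-comm (B₂ + 3) 1)) B₂+3≤B))

sortable-within-bound : ∀ F n → 1 ≤ n → ∀ π → IsPerm n π → b n π ≤ F → PbidAtMost n π (bound (b n π))
sortable-within-bound F n 1≤n π P b≤F with fixedUpTo? π n
... | yes fixed = 0 , z≤n , [] , refl , [] , fixed⇒identity n π fixed
... | no not-fixed with progress n π P 1≤n not-fixed | F
...   | _ | zero = ⊥-elim (1+n≰n (≤-trans (b≥1 n π) b≤F))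
...   | sorted-by-one m sorted | suc _ =
  1 , bound-one-move (b n π) (≤-trans (s≤s (b≥1 n (Move.result m))) (Move.gain m)) ,
  sortable-cons n π (Move.interchange m) 0 (Move.valid m) ([] , refl , [] , sorted)
...   | three-by-two m₁ m₂ 3≤g | suc F′ with sortable-within-bound F′ n 1≤n (Move.result m₂) (Move.result-perm m₂)
                                           (s≤s⁻¹ (≤-trans (≤-trans (m≤n+m _ 2) (gain-of-two-moves m₁ m₂ 3≤g)) b≤F))
...     | t , t≤ , sorts =
  suc (suc t) ,
  bound-two-moves (b n π) (b n (Move.result m₂)) t (b≥1 n _) (≤-trans (≤-reflexive (+-comm _ 3)) (gain-of-two-moves m₁ m₂ 3≤g)) t≤ ,
  sortable-cons n π (Move.interchange m₁) (suc t) (Move.valid m₁)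
    (sortable-cons n (Move.result m₁) (Move.interchange m₂) t (Move.valid m₂) sorts)

lemma5p4 : (n : ℕ) → 1 ≤ n → (π : ℕ → ℕ) → IsPerm n π →
    PbidAtMost n π (2 * (((b n π ∸ 1) + 2) / 3))
lemma5p4 n 1≤n π P = sortable-within-bound (b n π) n 1≤n π P ≤-refl
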